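{- Let $H$ be a graph on $k\ge 3$ vertices. Let $s$ be a positive integer and let $\eta>0$. If $G$ is an $(H,\eta^2 s)$-rich graph, then for every pair of disjoint sets $X,Y\subset V(G)$ with $|X|=|Y|=s$ and every $2$-colouring of the edges of $G$ such that (i) $G[X]$ contains a blue $H$-tiling with $s/k$ copies of $H$, and (ii) $G[Y]$ contains a red $H$-tiling with $s/k$ copies of $H$, there exists a vertex set $T\subset X\cup Y$ such that $G[T]$ (with the inherited colouring) is an $(H,\eta)$-cluster.
   Context: Floors and ceilings are omitted and divisibility is assumed where needed. $\alpha=\alpha(H)$ is the independence number of $H$. A copy of $H$ is a subgraph isomorphic to $H$; it is red (blue) if all its edges are red (blue). A red (blue) $H$-tiling is a collection of vertex-disjoint red (blue) copies of $H$. A graph $G$ is $(H,t)$-rich if for every $2$-colouring (red/blue) of the edges of $G$ and every pair of disjoint sets $X',Y'\subset V(G)$ with $|X'|=|Y'|=t$, at least one of the following holds: there is a red copy $H'$ of $H$ in $G[X'\cup Y']$ with $|V(H')\cap X'|\ge\alpha(H)$, or there is a blue copy $H'$ of $H$ in $G[X'\cup Y']$ with $|V(H')\cap Y'|\ge\alpha(H)$. For $\eta\ge 0$, a nonempty $2$-coloured graph $F$ is an $(H,\eta)$-cluster if it contains both a red $H$-tiling and a blue $H$-tiling, each with at least $v(F)/(2k-\alpha)-\eta v(F)$ copies of $H$.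
   Formalization: The parameter η ranges over the positive rationals. -}

module Defs where

open import Data.Nat as ℕ using (ℕ; zero; suc; _≤_; _∸_)
open import Data.Integer as ℤ using (+_)
open import Data.Rational as ℚ using (ℚ)
open import Data.Fin using (Fin)
open import Data.Fin.Subset using (Subset; _∈_; _∉_; ∣_∣; _∪_; _⊆_)
open import Data.Vec using (tabulate; lookup)
open import Data.Sum using (_⊎_)
open import Data.Bool using (Bool; true; false)
open import Data.Product using (Σ; _×_; ∃-syntax)
open import Relation.Binary.PropositionalEquality using (_≡_; _≢_)

record Graph (n : ℕ) : Set where
  field
    adj    : Fin n → Fin n → Bool
    sym    : ∀ u v → adj u v ≡ adj v u
    irrefl : ∀ v → adj v v ≡ false
open Graph public

data Colour : Set where
  red blue : Colour

-- A 2-colouring of the edges of G: a symmetric colour assignment to pairs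
-- (only its values on edges of G matter).
record Colouring {n : ℕ} (G : Graph n) : Set where
  field
    col    : Fin n → Fin n → Colour
    colSym : ∀ u v → col u v ≡ col v u
open Colouring public

Independent : ∀ {k} → Graph k → Subset k → Set
Independent H S = ∀ u v → u ∈ S → v ∈ S → adj H u v ≡ false

IsIndependenceNumber : ∀ {k} → Graph k → ℕ → Set
IsIndependenceNumber {k} H a =
  Σ (Subset k) (λ S → Independent H S × ∣ S ∣ ≡ a)
  × (∀ S → Independent H S → ∣ S ∣ ≤ a)

IsCopy : ∀ {k n} → Graph k → Graph n → (Fin k → Fin n) → Set
IsCopy H G φ =
  (∀ i j → φ i ≡ φ j → i ≡ j)
  × (∀ i j → adj H i j ≡ true → adj G (φ i) (φ j) ≡ true)

Monochromatic : ∀ {k n} {G : Graph n} → Graph k → Colouring G → Colour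
              → (Fin k → Fin n) → Set
Monochromatic H χ c φ = ∀ i j → adj H i j ≡ true → col χ (φ i) (φ j) ≡ c

Inside : ∀ {k n} → (Fin k → Fin n) → Subset n → Set
Inside φ S = ∀ i → φ i ∈ S

-- |V(H') ∩ X| : number of vertices i of H with φ i ∈ X
countIn : ∀ {k n} → (Fin k → Fin n) → Subset n → ℕ
countIn φ X = ∣ tabulate (λ i → lookup X (φ i)) ∣

Tiling : ∀ {k n} (H : Graph k) (G : Graph n) → Colouring G → Colour
       → Subset n → ℕ → Set
Tiling {k} {n} H G χ c S m =
  Σ (Fin m → Fin k → Fin n) λ φ →
    (∀ a → IsCopy H G (φ a) × Monochromatic H χ c (φ a) × Inside (φ a) S)
    × (∀ a b i j → a ≢ b → φ a i ≢ φ b j)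

Disjoint : ∀ {n} → Subset n → Subset n → Set
Disjoint X Y = ∀ v → v ∈ X → v ∉ Y

-- (H,t)-rich graphs (α is the independence number of H).

Rich : ∀ {k n} (H : Graph k) (α : ℕ) (G : Graph n) (t : ℕ) → Set
Rich {k} {n} H α G t =
  ∀ (χ : Colouring G) (X' Y' : Subset n) → Disjoint X' Y' →
    ∣ X' ∣ ≡ t → ∣ Y' ∣ ≡ t →
    (Σ (Fin k → Fin n) λ φ → IsCopy H G φ × Monochromatic H χ red φ
        × Inside φ (X' ∪ Y') × α ≤ countIn φ X')
    ⊎
    (Σ (Fin k → Fin n) λ φ → IsCopy H G φ × Monochromatic H χ blue φ
        × Inside φ (X' ∪ Y') × α ≤ countIn φ Y')

toℚ : ℕ → ℚ
toℚ n = + n ℚ./ 1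

-- a / d as a rational (junk value 0 when d = 0; only used with d > 0)
_/ℕ_ : ℕ → ℕ → ℚ
a /ℕ zero    = ℚ.0ℚ
a /ℕ (suc d) = + a ℚ./ suc d

Cluster : ∀ {k n} (H : Graph k) (α : ℕ) (G : Graph n) → Colouring G
        → ℚ → Subset n → Set
Cluster {k} H α G χ η T =
  0 ℕ.< ∣ T ∣
  × (Σ ℕ λ m → Tiling H G χ red T m
       × (∣ T ∣ /ℕ (2 ℕ.* k ∸ α)) ℚ.- η ℚ.* toℚ ∣ T ∣ ℚ.≤ toℚ m)
  × (Σ ℕ λ m → Tiling H G χ blue T m
       × (∣ T ∣ /ℕ (2 ℕ.* k ∸ α)) ℚ.- η ℚ.* toℚ ∣ T ∣ ℚ.≤ toℚ m)

-- Put t = ⌊η²s⌋ and d = 2k − α.  If η ≥ 1/d, the bound |T|/d − η|T| is not positive and T = X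
-- is a cluster with empty tilings.  Otherwise run a greedy process on the blue tiling of X and
-- the red tiling of Y.  While neither tiling is exhausted, choose t unused vertices among the
-- first few blue copies in X and t among the first few red copies in Y; richness yields a red
-- copy with at least α vertices in the first set or a blue copy with at least α vertices in the
-- second, vertex-disjoint from all copies found so far.  The used vertices of each side stay
-- inside its first ⌈(#used + t)/k⌉ tiling copies.  When the process stops with p red and q ≤ p
-- blue copies, s ≤ 2kp + t, and T = (the first N = max(p, depth of X) blue copies) ∪ (the
-- vertices of the red copies in Y) carries a blue tiling of size N and a red one of size p.
-- A red copy has at most k − α vertices in Y, so |T| ≤ dN; the depth bound gives
-- |T| ≤ dp + tk, and tk ≤ ηd²p (from t ≤ η²s, s ≤ 2kp + t and η < 1/d), which is enough for
-- p ≥ |T|/d − η|T|.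

module Submission where

open import Defs
open import Data.Nat
  using (ℕ; zero; suc; _+_; _*_; _∸_; _/_; _⊔_; _≤_; _<_; z≤n; s≤s; NonZero; >-nonZero)
open import Data.Nat.Properties as ℕ
  using (≤-refl; ≤-trans; ≤-reflexive; +-mono-≤; +-monoˡ-≤; +-monoʳ-≤; m≤m+n; +-suc)
open import Data.Nat.DivMod using (m/n*n≤m)
open import Data.Nat.Tactic.RingSolver using (solve-∀)
open import Data.Integer as ℤ using (ℤ; +_; -[1+_]; +≤+; ∣_∣)
import Data.Integer.Properties as ℤₚ
import Data.Integer.Tactic.RingSolver as ℤ-Solver
open import Data.Rational as ℚ
  using (ℚ; mkℚ; 0ℚ; floor; *<*) renaming (_<_ to _<ℚ_; _*_ to _*ℚ_)
import Data.Rational.Properties as ℚₚ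
open import Data.Rational.Unnormalised as ℚᵘ using (ℚᵘ; mkℚᵘ; *≤*; *≡*)
import Data.Rational.Unnormalised.Properties as ℚᵘₚ
open import Data.Fin using (Fin; zero; suc; toℕ; inject≤; fromℕ<)
open import Data.Fin.Properties using (toℕ<n; suc-injective; toℕ-inject≤; inject≤-injective)
open import Data.Fin.Subset
  using (Subset; inside; outside; _∈_; _∉_; _⊆_; _∪_; _∩_; ∁; ⊥; ⁅_⁆)
  renaming (∣_∣ to size)
open import Data.Fin.Subset.Properties
  using ( ∣⊥∣≡0; ∉⊥; ∣⁅x⁆∣≡1; x∈⁅x⁆; x∈⁅y⁆⇒x≡y; p⊆q⇒∣p∣≤∣q∣; ∣p∣≤n; ∣p∣≤∣p∪q∣; ∣p∩q∣≤∣q∣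
        ; _∈?_; x∈p∪q⁻; x∈p∪q⁺; p⊆p∪q; q⊆p∪q; x∈p∩q⁺; x∈p∩q⁻; p∩q⊆p; x∉p⇒x∈∁p; x∈∁p⇒x∉p
        ; s⊆s; ∩-distribˡ-∪; ∪-comm)
open import Data.Vec using ([]; _∷_; lookup; tabulate)
open import Data.Vec.Properties using ([]=⇒lookup; lookup⇒[]=; lookup∘tabulate)
open import Data.Product using (Σ; ∃-syntax; _×_; _,_; proj₁; proj₂) renaming (swap to ×-swap)
open import Data.Sum using (_⊎_; inj₁; inj₂; [_,_]′) renaming (swap to ⊎-swap)
open import Data.Empty using (⊥-elim)
open import Function using (_∘_)
open import Relation.Nullary using (¬_; yes; no)
open import Relation.Binary.PropositionalEquality
  using (_≡_; _≢_; refl; cong; cong₂; subst; trans; module ≡-Reasoning) renaming (sym to ≡-sym)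

private variable n : ℕ

-- Cardinalities of finite sets

∣p∪q∣+∣p∩q∣≡∣p∣+∣q∣ : (p q : Subset n) → size (p ∪ q) + size (p ∩ q) ≡ size p + size q
∣p∪q∣+∣p∩q∣≡∣p∣+∣q∣ []            []            = refl
∣p∪q∣+∣p∩q∣≡∣p∣+∣q∣ (inside ∷ p)  (inside ∷ q)  = cong suc (begin
  size (p ∪ q) + suc (size (p ∩ q)) ≡⟨ +-suc (size (p ∪ q)) (size (p ∩ q)) ⟩
  suc (size (p ∪ q) + size (p ∩ q)) ≡⟨ cong suc (∣p∪q∣+∣p∩q∣≡∣p∣+∣q∣ p q) ⟩
  suc (size p + size q)             ≡⟨ +-suc (size p) (size q) ⟨
  size p + suc (size q)             ∎)
  where open ≡-Reasoning
∣p∪q∣+∣p∩q∣≡∣p∣+∣q∣ (inside ∷ p)  (outside ∷ q) = cong suc (∣p∪q∣+∣p∩q∣≡∣p∣+∣q∣ p q)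
∣p∪q∣+∣p∩q∣≡∣p∣+∣q∣ (outside ∷ p) (inside ∷ q)  =
  trans (cong suc (∣p∪q∣+∣p∩q∣≡∣p∣+∣q∣ p q)) (≡-sym (+-suc (size p) (size q)))
∣p∪q∣+∣p∩q∣≡∣p∣+∣q∣ (outside ∷ p) (outside ∷ q) = ∣p∪q∣+∣p∩q∣≡∣p∣+∣q∣ p q

∣p∪q∣≤∣p∣+∣q∣ : (p q : Subset n) → size (p ∪ q) ≤ size p + size q
∣p∪q∣≤∣p∣+∣q∣ p q = subst (size (p ∪ q) ≤_) (∣p∪q∣+∣p∩q∣≡∣p∣+∣q∣ p q) (m≤m+n _ _)

Disjoint⇒∣p∩q∣≡0 : (p q : Subset n) → Disjoint p q → size (p ∩ q) ≡ 0
Disjoint⇒∣p∩q∣≡0 {n} p q p∩q=∅ =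
  ℕ.n≤0⇒n≡0 (≤-trans (p⊆q⇒∣p∣≤∣q∣ p∩q⊆⊥) (≤-reflexive (∣⊥∣≡0 n)))
  where
  p∩q⊆⊥ : p ∩ q ⊆ ⊥
  p∩q⊆⊥ {x} x∈p∩q with x∈p∩q⁻ p q x∈p∩q
  ... | x∈p , x∈q = ⊥-elim (p∩q=∅ x x∈p x∈q)

Disjoint⇒∣p∪q∣≡∣p∣+∣q∣ : (p q : Subset n) → Disjoint p q → size (p ∪ q) ≡ size p + size q
Disjoint⇒∣p∪q∣≡∣p∣+∣q∣ p q p∩q=∅ = begin
  size (p ∪ q)                ≡⟨ ℕ.+-identityʳ _ ⟨
  size (p ∪ q) + 0            ≡⟨ cong (_+_ (size (p ∪ q))) (Disjoint⇒∣p∩q∣≡0 p q p∩q=∅) ⟨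
  size (p ∪ q) + size (p ∩ q) ≡⟨ ∣p∪q∣+∣p∩q∣≡∣p∣+∣q∣ p q ⟩
  size p + size q             ∎
  where open ≡-Reasoning

∣p∣≤∣p∩∁q∣+∣q∣ : (p q : Subset n) → size p ≤ size (p ∩ ∁ q) + size q
∣p∣≤∣p∩∁q∣+∣q∣ p q =
  ≤-trans (p⊆q⇒∣p∣≤∣q∣ p⊆[p∩∁q]∪q) (∣p∪q∣≤∣p∣+∣q∣ (p ∩ ∁ q) q)
  where
  p⊆[p∩∁q]∪q : p ⊆ (p ∩ ∁ q) ∪ q
  p⊆[p∩∁q]∪q {x} x∈p with x ∈? q
  ... | yes x∈q = x∈p∪q⁺ (inj₂ x∈q)
  ... | no  x∉q = x∈p∪q⁺ (inj₁ (x∈p∩q⁺ (x∈p , x∉p⇒x∈∁p x∉q)))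

∃-⊆-of-size : ∀ t (p : Subset n) → t ≤ size p → ∃[ q ] q ⊆ p × size q ≡ t
∃-⊆-of-size {n} zero p _ = ⊥ , (λ x∈⊥ → ⊥-elim (∉⊥ x∈⊥)) , ∣⊥∣≡0 n
∃-⊆-of-size (suc t) (inside ∷ p) (s≤s t≤∣p∣) with ∃-⊆-of-size t p t≤∣p∣
... | q , q⊆p , ∣q∣≡t = inside ∷ q , s⊆s q⊆p , cong suc ∣q∣≡t
∃-⊆-of-size (suc t) (outside ∷ p) t≤∣p∣ with ∃-⊆-of-size (suc t) p t≤∣p∣
... | q , q⊆p , ∣q∣≡t = outside ∷ q , s⊆s q⊆p , ∣q∣≡t

-- Unions of families, images and prefixes of tilings

∪-least : {p q r : Subset n} → p ⊆ r → q ⊆ r → p ∪ q ⊆ r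
∪-least {p = p} {q} p⊆r q⊆r x∈p∪q with x∈p∪q⁻ p q x∈p∪q
... | inj₁ x∈p = p⊆r x∈p
... | inj₂ x∈q = q⊆r x∈q

⋃-first : ∀ {m} → ℕ → (Fin m → Subset n) → Subset n
⋃-first {m = zero}  _       _ = ⊥
⋃-first {m = suc m} zero    _ = ⊥
⋃-first {m = suc m} (suc N) A = A zero ∪ ⋃-first N (A ∘ suc)

⊆-⋃-first : ∀ {m} N (A : Fin m → Subset n) a → toℕ a < N → A a ⊆ ⋃-first N A
⊆-⋃-first (suc N) A zero    _             = p⊆p∪q _
⊆-⋃-first (suc N) A (suc a) (s≤s a<N) x∈A =
  q⊆p∪q (A zero) _ (⊆-⋃-first N (A ∘ suc) a a<N x∈A)

∈-⋃-first⁻ : ∀ {m} N (A : Fin m → Subset n) {x} → x ∈ ⋃-first N A → ∃[ a ] x ∈ A a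
∈-⋃-first⁻ {m = zero}  N       A x∈⋃ = ⊥-elim (∉⊥ x∈⋃)
∈-⋃-first⁻ {m = suc m} zero    A x∈⋃ = ⊥-elim (∉⊥ x∈⋃)
∈-⋃-first⁻ {m = suc m} (suc N) A x∈⋃ with x∈p∪q⁻ (A zero) _ x∈⋃
... | inj₁ x∈A₀ = zero , x∈A₀
... | inj₂ x∈⋃′ with ∈-⋃-first⁻ N (A ∘ suc) x∈⋃′
...   | a , x∈Aa = suc a , x∈Aa

⋃-first-mono : ∀ {m N N′} (A : Fin m → Subset n) → N ≤ N′ → ⋃-first N A ⊆ ⋃-first N′ A
⋃-first-mono {m = zero}                   A _          x∈⋃ = x∈⋃
⋃-first-mono {m = suc m} {zero}           A _          x∈⋃ = ⊥-elim (∉⊥ x∈⋃)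
⋃-first-mono {m = suc m} {suc N} {suc N′} A (s≤s N≤N′) x∈⋃ with x∈p∪q⁻ (A zero) _ x∈⋃
... | inj₁ x∈A₀ = p⊆p∪q _ x∈A₀
... | inj₂ x∈⋃′ = q⊆p∪q (A zero) _ (⋃-first-mono (A ∘ suc) N≤N′ x∈⋃′)

∣⋃-first∣≤ : ∀ {m c} N (A : Fin m → Subset n) → (∀ a → size (A a) ≤ c) →
             size (⋃-first N A) ≤ c * N
∣⋃-first∣≤ {n} {zero}  N       A _ = ≤-trans (≤-reflexive (∣⊥∣≡0 n)) z≤n
∣⋃-first∣≤ {n} {suc m} zero    A _ = ≤-trans (≤-reflexive (∣⊥∣≡0 n)) z≤n
∣⋃-first∣≤ {n} {suc m} {c} (suc N) A ∣A∣≤c = begin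
  size (A zero ∪ ⋃-first N (A ∘ suc))
    ≤⟨ ∣p∪q∣≤∣p∣+∣q∣ (A zero) _ ⟩
  size (A zero) + size (⋃-first N (A ∘ suc))
    ≤⟨ +-mono-≤ (∣A∣≤c zero) (∣⋃-first∣≤ N (A ∘ suc) (∣A∣≤c ∘ suc)) ⟩
  c + c * N
    ≡⟨ ℕ.*-suc c N ⟨
  c * suc N ∎
  where open ℕ.≤-Reasoning

PairwiseDisjoint : ∀ {m} → (Fin m → Subset n) → Set
PairwiseDisjoint A = ∀ a b → a ≢ b → Disjoint (A a) (A b)

∣⋃-first∣≥ : ∀ {m c} N (A : Fin m → Subset n) → PairwiseDisjoint A →
             (∀ a → c ≤ size (A a)) → N ≤ m → c * N ≤ size (⋃-first N A)
∣⋃-first∣≥ {c = c} zero A _ _ _ = ≤-trans (≤-reflexive (ℕ.*-zeroʳ c)) z≤n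
∣⋃-first∣≥ {m = suc m} {c} (suc N) A disj c≤∣A∣ (s≤s N≤m) = begin
  c * suc N
    ≡⟨ ℕ.*-suc c N ⟩
  c + c * N
    ≤⟨ +-mono-≤ (c≤∣A∣ zero) (∣⋃-first∣≥ N (A ∘ suc) disj′ (c≤∣A∣ ∘ suc) N≤m) ⟩
  size (A zero) + size (⋃-first N (A ∘ suc))
    ≡⟨ Disjoint⇒∣p∪q∣≡∣p∣+∣q∣ (A zero) _ A₀∩⋃=∅ ⟨
  size (A zero ∪ ⋃-first N (A ∘ suc)) ∎
  where
  open ℕ.≤-Reasoning
  disj′ : PairwiseDisjoint (A ∘ suc)
  disj′ a b a≢b = disj (suc a) (suc b) (a≢b ∘ suc-injective)
  A₀∩⋃=∅ : Disjoint (A zero) (⋃-first N (A ∘ suc))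
  A₀∩⋃=∅ x x∈A₀ x∈⋃ with ∈-⋃-first⁻ N (A ∘ suc) x∈⋃
  ... | a , x∈Aa = disj zero (suc a) (λ ()) x x∈A₀ x∈Aa

image : ∀ {k} → (Fin k → Fin n) → Subset n
image {k = k} φ = ⋃-first k (⁅_⁆ ∘ φ)

∈-image : ∀ {k} (φ : Fin k → Fin n) i → φ i ∈ image φ
∈-image φ i = ⊆-⋃-first _ (⁅_⁆ ∘ φ) i (toℕ<n i) (x∈⁅x⁆ (φ i))

∈-image⁻ : ∀ {k} (φ : Fin k → Fin n) {x} → x ∈ image φ → ∃[ i ] φ i ≡ x
∈-image⁻ φ x∈im with ∈-⋃-first⁻ _ (⁅_⁆ ∘ φ) x∈im
... | i , x∈⁅φi⁆ = i , ≡-sym (x∈⁅y⁆⇒x≡y (φ i) x∈⁅φi⁆)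

∣image∣≤ : ∀ {k} (φ : Fin k → Fin n) → size (image φ) ≤ k
∣image∣≤ {k = k} φ = subst (size (image φ) ≤_) (ℕ.*-identityˡ k)
  (∣⋃-first∣≤ k (⁅_⁆ ∘ φ) (≤-reflexive ∘ ∣⁅x⁆∣≡1 ∘ φ))

∣image∣≥ : ∀ {k} (φ : Fin k → Fin n) → (∀ i j → φ i ≡ φ j → i ≡ j) → k ≤ size (image φ)
∣image∣≥ {k = k} φ injective = subst (_≤ size (image φ)) (ℕ.*-identityˡ k)
  (∣⋃-first∣≥ k (⁅_⁆ ∘ φ) disjoint (≤-reflexive ∘ ≡-sym ∘ ∣⁅x⁆∣≡1 ∘ φ) ≤-refl)
  where
  disjoint : PairwiseDisjoint (⁅_⁆ ∘ φ)
  disjoint i j i≢j x x∈⁅φi⁆ x∈⁅φj⁆ = i≢j (injective i j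
    (trans (≡-sym (x∈⁅y⁆⇒x≡y (φ i) x∈⁅φi⁆)) (x∈⁅y⁆⇒x≡y (φ j) x∈⁅φj⁆)))

∈-preimage⁻ : ∀ {k} (φ : Fin k → Fin n) (S : Subset n) {i} →
              i ∈ tabulate (λ j → lookup S (φ j)) → φ i ∈ S
∈-preimage⁻ φ S {i} i∈φ⁻¹S = lookup⇒[]= (φ i) S
  (trans (≡-sym (lookup∘tabulate (λ j → lookup S (φ j)) i)) ([]=⇒lookup i∈φ⁻¹S))

countIn-disjoint : ∀ {k} (φ : Fin k → Fin n) (X Y : Subset n) → Disjoint X Y →
                   countIn φ X + countIn φ Y ≤ k
countIn-disjoint {k = k} φ X Y X∩Y=∅ = begin
  countIn φ X + countIn φ Y ≡⟨ Disjoint⇒∣p∪q∣≡∣p∣+∣q∣ φ⁻¹X φ⁻¹Y φ⁻¹X∩φ⁻¹Y=∅ ⟨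
  size (φ⁻¹X ∪ φ⁻¹Y)        ≤⟨ ∣p∣≤n (φ⁻¹X ∪ φ⁻¹Y) ⟩
  k                         ∎
  where
  open ℕ.≤-Reasoning
  φ⁻¹X = tabulate (λ i → lookup X (φ i))
  φ⁻¹Y = tabulate (λ i → lookup Y (φ i))
  φ⁻¹X∩φ⁻¹Y=∅ : Disjoint φ⁻¹X φ⁻¹Y
  φ⁻¹X∩φ⁻¹Y=∅ i i∈φ⁻¹X i∈φ⁻¹Y =
    X∩Y=∅ (φ i) (∈-preimage⁻ φ X i∈φ⁻¹X) (∈-preimage⁻ φ Y i∈φ⁻¹Y)

∣p∩⁅x⁆∣+∣v∣≤∣p[x]∷v∣ : ∀ {k} (p : Subset n) x (v : Subset k) →
                       size (p ∩ ⁅ x ⁆) + size v ≤ size (lookup p x ∷ v)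
∣p∩⁅x⁆∣+∣v∣≤∣p[x]∷v∣ p x v with lookup p x in p[x]≡b
... | inside  = +-monoˡ-≤ (size v) (subst (size (p ∩ ⁅ x ⁆) ≤_) (∣⁅x⁆∣≡1 x) (∣p∩q∣≤∣q∣ p ⁅ x ⁆))
... | outside = ≤-reflexive (cong (_+ size v) (Disjoint⇒∣p∩q∣≡0 p ⁅ x ⁆ p∩⁅x⁆=∅))
  where
  p∩⁅x⁆=∅ : Disjoint p ⁅ x ⁆
  p∩⁅x⁆=∅ y y∈p y∈⁅x⁆ with x∈⁅y⁆⇒x≡y x y∈⁅x⁆
  ... | refl with trans (≡-sym ([]=⇒lookup y∈p)) p[x]≡b
  ...   | ()

∣p∩image∣≤countIn : ∀ {k} (φ : Fin k → Fin n) (S : Subset n) → size (S ∩ image φ) ≤ countIn φ S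
∣p∩image∣≤countIn {n} {zero}  φ S = subst (size (S ∩ ⊥) ≤_) (∣⊥∣≡0 n) (∣p∩q∣≤∣q∣ S ⊥)
∣p∩image∣≤countIn {n} {suc k} φ S = begin
  size (S ∩ (⁅ φ zero ⁆ ∪ image (φ ∘ suc)))
    ≡⟨ cong size (∩-distribˡ-∪ S ⁅ φ zero ⁆ _) ⟩
  size ((S ∩ ⁅ φ zero ⁆) ∪ (S ∩ image (φ ∘ suc)))
    ≤⟨ ∣p∪q∣≤∣p∣+∣q∣ (S ∩ ⁅ φ zero ⁆) _ ⟩
  size (S ∩ ⁅ φ zero ⁆) + size (S ∩ image (φ ∘ suc))
    ≤⟨ +-monoʳ-≤ (size (S ∩ ⁅ φ zero ⁆)) (∣p∩image∣≤countIn (φ ∘ suc) S) ⟩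
  size (S ∩ ⁅ φ zero ⁆) + countIn (φ ∘ suc) S
    ≤⟨ ∣p∩⁅x⁆∣+∣v∣≤∣p[x]∷v∣ S (φ zero) (tabulate (λ i → lookup S (φ (suc i)))) ⟩
  countIn φ S ∎
  where open ℕ.≤-Reasoning

Tiling-⊆ : ∀ {k m} {H : Graph k} {G : Graph n} {χ : Colouring G} {c S S′} →
           S ⊆ S′ → Tiling H G χ c S m → Tiling H G χ c S′ m
Tiling-⊆ S⊆S′ (φ , valid , disjoint) =
  φ , (λ a → proj₁ (valid a) , proj₁ (proj₂ (valid a)) , S⊆S′ ∘ proj₂ (proj₂ (valid a))) , disjoint

cover : ∀ {m k} → (Fin m → Fin k → Fin n) → ℕ → Subset n
cover φ N = ⋃-first N (image ∘ φ)

module _ {m k : ℕ} (φ : Fin m → Fin k → Fin n) where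

  ∈-cover : ∀ {N} a i → toℕ a < N → φ a i ∈ cover φ N
  ∈-cover a i a<N = ⊆-⋃-first _ (image ∘ φ) a a<N (∈-image (φ a) i)

  ∈-cover⁻ : ∀ {N x} → x ∈ cover φ N → ∃[ a ] ∃[ i ] φ a i ≡ x
  ∈-cover⁻ x∈cover with ∈-⋃-first⁻ _ (image ∘ φ) x∈cover
  ... | a , x∈φa = a , ∈-image⁻ (φ a) x∈φa

  cover-mono : ∀ {N N′} → N ≤ N′ → cover φ N ⊆ cover φ N′
  cover-mono = ⋃-first-mono (image ∘ φ)

  ∣cover∣≤ : ∀ N → size (cover φ N) ≤ k * N
  ∣cover∣≤ N = ∣⋃-first∣≤ N (image ∘ φ) (∣image∣≤ ∘ φ)

module _ {k m} {H : Graph k} {G : Graph n} {χ : Colouring G} {c S}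
         (tiling : Tiling H G χ c S m) where

  private
    φ = proj₁ tiling
    valid = proj₁ (proj₂ tiling)
    disjoint = proj₂ (proj₂ tiling)

  cover⊆ : ∀ N → cover φ N ⊆ S
  cover⊆ N x∈cover with ∈-cover⁻ φ x∈cover
  ... | a , i , refl = proj₂ (proj₂ (valid a)) i

  first-copies : ∀ N → N ≤ m → Tiling H G χ c (cover φ N) N
  first-copies N N≤m = ψ , (λ a → proj₁ (valid (ι a)) , proj₁ (proj₂ (valid (ι a))) , ψa⊆cover a)
                         , ψ-disjoint
    where
    ι : Fin N → Fin m
    ι a = inject≤ a N≤m
    ψ : Fin N → Fin k → Fin n
    ψ = φ ∘ ι
    ψa⊆cover : ∀ a → Inside (ψ a) (cover φ N)
    ψa⊆cover a i = ∈-cover φ (ι a) i (subst (_< N) (≡-sym (toℕ-inject≤ a N≤m)) (toℕ<n a))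
    ψ-disjoint : ∀ a b i j → a ≢ b → ψ a i ≢ ψ b j
    ψ-disjoint a b i j a≢b = disjoint (ι a) (ι b) i j (a≢b ∘ inject≤-injective N≤m N≤m a b)

  ∣cover∣≥ : ∀ N → N ≤ m → k * N ≤ size (cover φ N)
  ∣cover∣≥ N N≤m = ∣⋃-first∣≥ N (image ∘ φ) images-disjoint
                     (λ a → ∣image∣≥ (φ a) (proj₁ (proj₁ (valid a)))) N≤m
    where
    images-disjoint : PairwiseDisjoint (image ∘ φ)
    images-disjoint a b a≢b x x∈φa x∈φb with ∈-image⁻ (φ a) x∈φa | ∈-image⁻ (φ b) x∈φb
    ... | i , φai≡x | j , φbj≡x = disjoint a b i j a≢b (trans φai≡x (≡-sym φbj≡x))

-- Arithmetic of the size bounds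

∃-ceiling : ∀ x {k} → 0 < k → ∃[ N ] x ≤ k * N × k * N < x + k
∃-ceiling zero    {k} 0<k = 0 , z≤n , subst (_< k) (≡-sym (ℕ.*-zeroʳ k)) 0<k
∃-ceiling (suc x) {k} 0<k with ∃-ceiling x 0<k
... | N , x≤kN , kN<x+k with suc x ℕ.≤? k * N
...   | yes x<kN = N , x<kN , ℕ.<-≤-trans kN<x+k (ℕ.n≤1+n (x + k))
...   | no  x≮kN = suc N , x<k[N+1] , k[N+1]<x+1+k
  where
  open ℕ.≤-Reasoning
  kN≡x : k * N ≡ x
  kN≡x = ℕ.≤-antisym (ℕ.≤-pred (ℕ.≰⇒> x≮kN)) x≤kN
  k[N+1]≡k+x : k * suc N ≡ k + x
  k[N+1]≡k+x = trans (ℕ.*-suc k N) (cong (_+_ k) kN≡x)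
  x<k[N+1] : suc x ≤ k * suc N
  x<k[N+1] = begin
    suc x     ≤⟨ +-monoˡ-≤ x 0<k ⟩
    k + x     ≡⟨ ≡-sym k[N+1]≡k+x ⟩
    k * suc N ∎
  k[N+1]<x+1+k : k * suc N < suc x + k
  k[N+1]<x+1+k = begin-strict
    k * suc N ≡⟨ k[N+1]≡k+x ⟩
    k + x     ≡⟨ ℕ.+-comm k x ⟩
    x + k     <⟨ ℕ.n<1+n (x + k) ⟩
    suc x + k ∎

ap+r≤bp⇒bN+r≤dN : ∀ {a b d p N r} → a ≤ b → a + d ≡ b + b → p ≤ N →
                   a * p + r ≤ b * p → b * N + r ≤ d * N
ap+r≤bp⇒bN+r≤dN {a} {b} {d} {p} {N} {r} a≤b a+d≡b+b p≤N ap+r≤bp =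
  ℕ.+-cancelˡ-≤ (a * N) _ _ (begin
  a * N + (b * N + r)         ≡⟨ cong (λ M → a * M + (b * N + r)) (ℕ.m+[n∸m]≡n p≤N) ⟨
  a * (p + x) + (b * N + r)   ≡⟨ regroup a p x (b * N) r ⟩
  b * N + (a * p + r) + a * x ≤⟨ +-mono-≤ (+-monoʳ-≤ (b * N) ap+r≤bp) (ℕ.*-monoˡ-≤ x a≤b) ⟩
  b * N + b * p + b * x       ≡⟨ ℕ.+-assoc (b * N) _ _ ⟩
  b * N + (b * p + b * x)     ≡⟨ cong (_+_ (b * N)) (ℕ.*-distribˡ-+ b p x) ⟨
  b * N + b * (p + x)         ≡⟨ cong (λ M → b * N + b * M) (ℕ.m+[n∸m]≡n p≤N) ⟩
  b * N + b * N               ≡⟨ ℕ.*-distribʳ-+ N b b ⟨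
  (b + b) * N                 ≡⟨ cong (_* N) a+d≡b+b ⟨
  (a + d) * N                 ≡⟨ ℕ.*-distribʳ-+ N a d ⟩
  a * N + d * N               ∎)
  where
  open ℕ.≤-Reasoning
  x : ℕ
  x = N ∸ p
  regroup : ∀ a p x y r → a * (p + x) + (y + r) ≡ y + (a * p + r) + a * x
  regroup = solve-∀

-- What the greedy process delivers for a vertex set of size T carrying tilings of sizes m₁, m₂.
Balanced : (k d t s : ℕ) → ℕ → ℕ → ℕ → Set
Balanced k d t s T m₁ m₂ = T ≤ d * m₁ × T < d * m₂ + t + k × s ≤ k * (m₂ + m₂) + t

t<s⇒0<m : ∀ {k m s t} → t < s → s ≤ k * (m + m) + t → 0 < m
t<s⇒0<m {k} {zero} {s} {t} t<s s≤t =
  ⊥-elim (ℕ.<⇒≱ t<s (subst (λ x → s ≤ x + t) (ℕ.*-zeroʳ k) s≤t))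
t<s⇒0<m {m = suc m} _ _ = s≤s z≤n

-- b T ≤ b d m + a d T is T/d − (a/b)·T ≤ m with the denominators cleared.
ClusterSize : (a b d T m : ℕ) → Set
ClusterSize a b d T m = b * T ≤ b * d * m + a * d * T

T≤dm⇒ClusterSize : ∀ {a b d T m} → T ≤ d * m → ClusterSize a b d T m
T≤dm⇒ClusterSize {a} {b} {d} {T} {m} T≤dm = begin
  b * T                 ≤⟨ ℕ.*-monoʳ-≤ b T≤dm ⟩
  b * (d * m)           ≡⟨ ≡-sym (ℕ.*-assoc b d m) ⟩
  b * d * m             ≤⟨ m≤m+n _ _ ⟩
  b * d * m + a * d * T ∎
  where open ℕ.≤-Reasoning

T≤dp+e⇒ClusterSize : ∀ {a b d T p e} → a * d ≤ b → T ≤ d * p + e → b * e ≤ a * d * (d * p) →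
                     ClusterSize a b d T p
T≤dp+e⇒ClusterSize {a} {b} {d} {T} {p} {e} ad≤b T≤dp+e be≤ad·dp = begin
  b * T                                     ≡⟨ cong (_* T) (ℕ.m+[n∸m]≡n ad≤b) ⟨
  (a * d + c) * T                           ≡⟨ ℕ.*-distribʳ-+ T (a * d) c ⟩
  a * d * T + c * T                         ≤⟨ +-monoʳ-≤ (a * d * T) (ℕ.*-monoʳ-≤ c T≤dp+e) ⟩
  a * d * T + c * (d * p + e)               ≡⟨ regroup (a * d * T) c (d * p) e ⟩
  a * d * T + c * (d * p) + c * e           ≤⟨ +-monoʳ-≤ _ (ℕ.*-monoˡ-≤ e (ℕ.m∸n≤m b (a * d))) ⟩
  a * d * T + c * (d * p) + b * e           ≤⟨ +-monoʳ-≤ _ be≤ad·dp ⟩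
  a * d * T + c * (d * p) + a * d * (d * p) ≡⟨ regroup′ (a * d * T) c (a * d) (d * p) ⟩
  (a * d + c) * (d * p) + a * d * T         ≡⟨ cong (λ x → x * (d * p) + a * d * T) (ℕ.m+[n∸m]≡n ad≤b) ⟩
  b * (d * p) + a * d * T                   ≡⟨ cong (_+ a * d * T) (ℕ.*-assoc b d p) ⟨
  b * d * p + a * d * T                     ∎
  where
  open ℕ.≤-Reasoning
  c : ℕ
  c = b ∸ a * d
  regroup : ∀ x c y e → x + c * (y + e) ≡ x + c * y + c * e
  regroup = solve-∀
  regroup′ : ∀ x c z y → x + c * y + z * y ≡ (z + c) * y + x
  regroup′ = solve-∀

3≤d⇒3a≤ad : ∀ {a d} → 3 ≤ d → 3 * a ≤ a * d
3≤d⇒3a≤ad {a} 3≤d = ≤-trans (≤-reflexive (ℕ.*-comm 3 a)) (ℕ.*-monoʳ-≤ a 3≤d)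

9t≤s : ∀ {a b t s} → 1 ≤ a → 3 * a ≤ b → t * (b * b) ≤ a * a * s → 9 * t ≤ s
9t≤s {a} {b} {t} {s} 1≤a 3a≤b tb²≤a²s = ℕ.*-cancelʳ-≤ (9 * t) s (a * a) {{a²≢0}} (begin
  9 * t * (a * a)         ≡⟨ regroup t a ⟩
  t * ((3 * a) * (3 * a)) ≤⟨ ℕ.*-monoʳ-≤ t (ℕ.*-mono-≤ 3a≤b 3a≤b) ⟩
  t * (b * b)             ≤⟨ tb²≤a²s ⟩
  a * a * s               ≡⟨ ℕ.*-comm (a * a) s ⟩
  s * (a * a)             ∎)
  where
  open ℕ.≤-Reasoning
  regroup : ∀ t a → 9 * t * (a * a) ≡ t * ((3 * a) * (3 * a))
  regroup = solve-∀
  a²≢0 : NonZero (a * a)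
  a²≢0 = >-nonZero (ℕ.*-mono-≤ 1≤a 1≤a)

4s≤9kp : ∀ {k p s t} → 9 * t ≤ s → s ≤ k * (p + p) + t → 4 * s ≤ 9 * (k * p)
4s≤9kp {k} {p} {s} {t} 9t≤s s≤2kp+t = ℕ.*-cancelˡ-≤ 2 (ℕ.+-cancelʳ-≤ s _ _ (begin
  2 * (4 * s) + s           ≡⟨ 9s s ⟩
  9 * s                     ≤⟨ ℕ.*-monoʳ-≤ 9 s≤2kp+t ⟩
  9 * (k * (p + p) + t)     ≡⟨ regroup k p t ⟩
  2 * (9 * (k * p)) + 9 * t ≤⟨ +-monoʳ-≤ _ 9t≤s ⟩
  2 * (9 * (k * p)) + s     ∎))
  where
  open ℕ.≤-Reasoning
  9s : ∀ s → 2 * (4 * s) + s ≡ 9 * s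
  9s = solve-∀
  regroup : ∀ k p t → 9 * (k * (p + p) + t) ≡ 2 * (9 * (k * p)) + 9 * t
  regroup = solve-∀

t+k≤tk+1 : ∀ {t k} → 1 ≤ t → 1 ≤ k → t + k ≤ t * k + 1
t+k≤tk+1 {suc t} {suc k} _ _ = subst (suc t + suc k ≤_) (≡-sym (expand t k)) (m≤m+n _ (t * k))
  where
  expand : ∀ t k → (1 + t) * (1 + k) + 1 ≡ (1 + t) + (1 + k) + t * k
  expand = solve-∀

nearly-dense⇒ClusterSize : ∀ {a b d k p s t T} → 3 ≤ k → k ≤ d → 1 ≤ a → a * d < b → 1 ≤ t →
                           t * (b * b) ≤ a * a * s → s ≤ k * (p + p) + t → T < d * p + t + k →
                           ClusterSize a b d T p
nearly-dense⇒ClusterSize {a} {b} {d} {k} {p} {s} {t} {T}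
                         3≤k k≤d 1≤a ad<b 1≤t tb²≤a²s s≤2kp+t T<dp+t+k =
  T≤dp+e⇒ClusterSize {a} (ℕ.<⇒≤ ad<b) T≤dp+tk btk≤ad·dp
  where
  open ℕ.≤-Reasoning
  3≤d : 3 ≤ d
  3≤d = ≤-trans 3≤k k≤d
  3a≤b : 3 * a ≤ b
  3a≤b = ≤-trans (3≤d⇒3a≤ad {a} 3≤d) (ℕ.<⇒≤ ad<b)
  4s≤9kp′ : 4 * s ≤ 9 * (k * p)
  4s≤9kp′ = 4s≤9kp {k} {p} (9t≤s {a} {b} {t} 1≤a 3a≤b tb²≤a²s) s≤2kp+t
  T≤dp+tk : T ≤ d * p + t * k
  T≤dp+tk = ℕ.≤-pred (begin
    suc T               ≤⟨ T<dp+t+k ⟩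
    d * p + t + k       ≡⟨ ℕ.+-assoc (d * p) t k ⟩
    d * p + (t + k)     ≤⟨ +-monoʳ-≤ (d * p) (t+k≤tk+1 1≤t (≤-trans (s≤s z≤n) 3≤k)) ⟩
    d * p + (t * k + 1) ≡⟨ ℕ.+-assoc (d * p) (t * k) 1 ⟨
    d * p + t * k + 1   ≡⟨ ℕ.+-comm _ 1 ⟩
    suc (d * p + t * k) ∎)
  9kk≤4ddd : 9 * k * k ≤ 4 * d * d * d
  9kk≤4ddd = begin
    9 * k * k     ≤⟨ ℕ.*-monoˡ-≤ k (ℕ.*-monoˡ-≤ k (ℕ.*-monoʳ-≤ 3 3≤d)) ⟩
    3 * d * k * k ≤⟨ ℕ.*-mono-≤ (ℕ.*-monoʳ-≤ (3 * d) k≤d) k≤d ⟩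
    3 * d * d * d ≤⟨ ℕ.*-monoˡ-≤ d (ℕ.*-monoˡ-≤ d (ℕ.*-monoˡ-≤ d (ℕ.n≤1+n 3))) ⟩
    4 * d * d * d ∎
  4b²tk≤4b·ad·dp : 4 * (b * (b * (t * k))) ≤ 4 * (b * (a * d * (d * p)))
  4b²tk≤4b·ad·dp = begin
    4 * (b * (b * (t * k)))         ≡⟨ regroup₁ b t k ⟩
    4 * (t * (b * b) * k)           ≤⟨ ℕ.*-monoʳ-≤ 4 (ℕ.*-monoˡ-≤ k tb²≤a²s) ⟩
    4 * (a * a * s * k)             ≡⟨ regroup₂ a s k ⟩
    a * a * k * (4 * s)             ≤⟨ ℕ.*-monoʳ-≤ (a * a * k) 4s≤9kp′ ⟩
    a * a * k * (9 * (k * p))       ≡⟨ regroup₃ a k p ⟩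
    a * a * p * (9 * k * k)         ≤⟨ ℕ.*-monoʳ-≤ (a * a * p) 9kk≤4ddd ⟩
    a * a * p * (4 * d * d * d)     ≡⟨ regroup₄ a p d ⟩
    4 * (a * d * (a * d * (d * p))) ≤⟨ ℕ.*-monoʳ-≤ 4 (ℕ.*-monoˡ-≤ _ (ℕ.<⇒≤ ad<b)) ⟩
    4 * (b * (a * d * (d * p)))     ∎
    where
    regroup₁ : ∀ b t k → 4 * (b * (b * (t * k))) ≡ 4 * (t * (b * b) * k)
    regroup₁ = solve-∀
    regroup₂ : ∀ a s k → 4 * (a * a * s * k) ≡ a * a * k * (4 * s)
    regroup₂ = solve-∀
    regroup₃ : ∀ a k p → a * a * k * (9 * (k * p)) ≡ a * a * p * (9 * k * k)
    regroup₃ = solve-∀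
    regroup₄ : ∀ a p d → a * a * p * (4 * d * d * d) ≡ 4 * (a * d * (a * d * (d * p)))
    regroup₄ = solve-∀
  btk≤ad·dp : b * (t * k) ≤ a * d * (d * p)
  btk≤ad·dp = ℕ.*-cancelˡ-≤ b {{>-nonZero (ℕ.≤-<-trans z≤n ad<b)}}
                (ℕ.*-cancelˡ-≤ 4 4b²tk≤4b·ad·dp)

Balanced⇒ClusterSize : ∀ {a b d k s t T m₁ m₂} → 3 ≤ k → k ≤ d → 1 ≤ a → a * d < b → 1 ≤ t →
                       t * (b * b) ≤ a * a * s → Balanced k d t s T m₁ m₂ →
                       ClusterSize a b d T m₁ × ClusterSize a b d T m₂
Balanced⇒ClusterSize {a} {b} 3≤k k≤d 1≤a ad<b 1≤t tb²≤a²s (T≤dm₁ , T<dm₂+t+k , s≤2km₂+t) =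
  T≤dm⇒ClusterSize {a} {b} T≤dm₁ ,
  nearly-dense⇒ClusterSize {a} {b} 3≤k k≤d 1≤a ad<b 1≤t tb²≤a²s s≤2km₂+t T<dm₂+t+k

-- From rationals to natural numbers

∣⌊q⌋∣*↧r≤↥r : ∀ (q : ℚ) (r : ℚᵘ) {N} → ℚ.toℚᵘ q ℚᵘ.≃ r → ℚᵘ.↥ r ≡ + N →
              ∣ floor q ∣ * ℚᵘ.↧ₙ r ≤ N
∣⌊q⌋∣*↧r≤↥r q@(mkℚ (+ M) d-1 _) (mkℚᵘ _ e-1) {N} (*≡* Me≡Nd) refl =
  ℕ.*-cancelʳ-≤ _ N d (begin
    ∣ floor q ∣ * e * d ≡⟨ cong (λ x → x * e * d) ∣⌊q⌋∣≡M/d ⟩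
    M / d * e * d         ≡⟨ ℕ.*-assoc (M / d) e d ⟩
    M / d * (e * d)       ≡⟨ cong (M / d *_) (ℕ.*-comm e d) ⟩
    M / d * (d * e)       ≡⟨ ≡-sym (ℕ.*-assoc (M / d) d e) ⟩
    M / d * d * e         ≤⟨ ℕ.*-monoˡ-≤ e (m/n*n≤m M d) ⟩
    M * e                 ≡⟨ ℤₚ.+-injective Me≡Nd′ ⟩
    N * d                 ∎)
  where
  open ℕ.≤-Reasoning
  d e : ℕ
  d = suc d-1
  e = suc e-1
  Me≡Nd′ : + (M * e) ≡ + (N * d)
  Me≡Nd′ = trans (ℤₚ.pos-* M e) (trans Me≡Nd (≡-sym (ℤₚ.pos-* N d)))
  ∣⌊q⌋∣≡M/d : ∣ floor q ∣ ≡ M / d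
  ∣⌊q⌋∣≡M/d = cong ∣_∣ (ℤₚ.*-identityˡ (+ (M / d)))
∣⌊q⌋∣*↧r≤↥r (mkℚ -[1+ _ ] d-1 _) (mkℚᵘ _ _) {N} (*≡* eq) refl
  with trans eq (≡-sym (ℤₚ.pos-* N (suc d-1)))
... | ()

positive⇒numerator : ∀ {η} → 0ℚ ℚ.< η → ∃[ a ] ℚ.↥ η ≡ + a × 1 ≤ a
positive⇒numerator {mkℚ (+ zero)  _ _} (*<* 0<0) = ⊥-elim (ℤₚ.<-irrefl refl 0<0)
positive⇒numerator {mkℚ (+ suc a) _ _} _         = suc a , refl , s≤s z≤n
positive⇒numerator {mkℚ -[1+ _ ]  _ _} (*<* ())

⌊η²s⌋-bound : ∀ η {a} → ℚ.↥ η ≡ + a → ∀ s →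
              ∣ floor (η ℚ.* η ℚ.* toℚ s) ∣ * (ℚ.↧ₙ η * ℚ.↧ₙ η) ≤ a * a * s
⌊η²s⌋-bound η@(mkℚ _ _ _) {a} refl s =
  subst (λ x → ∣ floor (η ℚ.* η ℚ.* toℚ s) ∣ * x ≤ a * a * s) (ℕ.*-identityʳ _)
        (∣⌊q⌋∣*↧r≤↥r (η ℚ.* η ℚ.* toℚ s) r η²s≃r ↥r≡a²s)
  where
  ηᵘ r : ℚᵘ
  ηᵘ = ℚ.toℚᵘ η
  r = ηᵘ ℚᵘ.* ηᵘ ℚᵘ.* mkℚᵘ (+ s) 0
  η²s≃r : ℚ.toℚᵘ (η ℚ.* η ℚ.* toℚ s) ℚᵘ.≃ r
  η²s≃r = ℚᵘₚ.≃-trans (ℚₚ.toℚᵘ-homo-* (η ℚ.* η) (toℚ s))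
            (ℚᵘₚ.*-cong (ℚₚ.toℚᵘ-homo-* η η) (ℚₚ.toℚᵘ-fromℚᵘ (mkℚᵘ (+ s) 0)))
  ↥r≡a²s : ℚᵘ.↥ r ≡ + (a * a * s)
  ↥r≡a²s = trans (cong (ℤ._* + s) (≡-sym (ℤₚ.pos-* a a))) (≡-sym (ℤₚ.pos-* (a * a) s))

-- The cross-multiplied form of T/d − (a/b)·T ≤ m/1 as ℚᵘ's _≤_ unfolds it (hence the factors 1).
ClusterSize⇒cross-multiplied : ∀ {a b d T m} → ClusterSize a b d T m →
  (+ T ℤ.* + (b * 1) ℤ.+ ℤ.- (+ a ℤ.* + T) ℤ.* + d) ℤ.* + 1 ℤ.≤ + m ℤ.* + (d * (b * 1))
ClusterSize⇒cross-multiplied {a} {b} {d} {T} {m} bT≤bdm+adT = begin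
  (+ T ℤ.* + (b * 1) ℤ.+ ℤ.- (+ a ℤ.* + T) ℤ.* + d) ℤ.* + 1
    ≡⟨ expand (+ T) (+ (b * 1)) (+ a) (+ d) ⟩
  + (b * 1) ℤ.* + T ℤ.- + a ℤ.* + d ℤ.* + T
    ≡⟨ cong₂ ℤ._-_ (≡-sym (ℤₚ.pos-* (b * 1) T)) +ad*+T≡+adT ⟩
  + (b * 1 * T) ℤ.- + (a * d * T)
    ≤⟨ ℤₚ.+-monoˡ-≤ (ℤ.- + (a * d * T)) (+≤+ b1T≤bdm+adT) ⟩
  + (b * d * m + a * d * T) ℤ.- + (a * d * T)
    ≡⟨ cong (ℤ._- + (a * d * T)) (ℤₚ.pos-+ (b * d * m) (a * d * T)) ⟩
  + (b * d * m) ℤ.+ + (a * d * T) ℤ.- + (a * d * T)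
    ≡⟨ cancel (+ (b * d * m)) (+ (a * d * T)) ⟩
  + (b * d * m)
    ≡⟨ cong +_ (reorder b d m) ⟩
  + (m * (d * (b * 1)))
    ≡⟨ ℤₚ.pos-* m (d * (b * 1)) ⟩
  + m ℤ.* + (d * (b * 1)) ∎
  where
  open ℤₚ.≤-Reasoning
  expand : ∀ T B a d →
           (T ℤ.* B ℤ.+ ℤ.- (a ℤ.* T) ℤ.* d) ℤ.* ℤ.+ 1 ≡ B ℤ.* T ℤ.- a ℤ.* d ℤ.* T
  expand = ℤ-Solver.solve-∀
  cancel : ∀ x y → x ℤ.+ y ℤ.- y ≡ x
  cancel = ℤ-Solver.solve-∀
  reorder : ∀ b d m → b * d * m ≡ m * (d * (b * 1))
  reorder = solve-∀
  b1T≤bdm+adT : b * 1 * T ≤ b * d * m + a * d * T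
  b1T≤bdm+adT = subst (λ x → x * T ≤ b * d * m + a * d * T) (≡-sym (ℕ.*-identityʳ b)) bT≤bdm+adT
  +ad*+T≡+adT : + a ℤ.* + d ℤ.* + T ≡ + (a * d * T)
  +ad*+T≡+adT = trans (cong (ℤ._* + T) (≡-sym (ℤₚ.pos-* a d))) (≡-sym (ℤₚ.pos-* (a * d) T))

ClusterSize⇒≤ : ∀ η {a d T m} → ℚ.↥ η ≡ + a → 1 ≤ d → ClusterSize a (ℚ.↧ₙ η) d T m →
                (T /ℕ d) ℚ.- η ℚ.* toℚ T ℚ.≤ toℚ m
ClusterSize⇒≤ η@(mkℚ _ b-1 _) {a} {suc d-1} {T} {m} refl _ bT≤bdm+adT =
  ℚₚ.toℚᵘ-cancel-≤ (begin
    ℚ.toℚᵘ ((T /ℕ d) ℚ.- η ℚ.* toℚ T)        ≃⟨ lhs≃ ⟩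
    mkℚᵘ (+ T) d-1 ℚᵘ.- ηᵘ ℚᵘ.* mkℚᵘ (+ T) 0 ≤⟨ *≤* (ClusterSize⇒cross-multiplied {a} {b} bT≤bdm+adT) ⟩
    mkℚᵘ (+ m) 0                             ≃⟨ ℚₚ.toℚᵘ-fromℚᵘ (mkℚᵘ (+ m) 0) ⟨
    ℚ.toℚᵘ (toℚ m)                           ∎)
  where
  open ℚᵘₚ.≤-Reasoning
  d b : ℕ
  d = suc d-1
  b = suc b-1
  ηᵘ : ℚᵘ
  ηᵘ = ℚ.toℚᵘ η
  lhs≃ : ℚ.toℚᵘ ((T /ℕ d) ℚ.- η ℚ.* toℚ T) ℚᵘ.≃
         mkℚᵘ (+ T) d-1 ℚᵘ.- ηᵘ ℚᵘ.* mkℚᵘ (+ T) 0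
  lhs≃ = ℚᵘₚ.≃-trans (ℚₚ.toℚᵘ-homo-+ (T /ℕ d) (ℚ.- (η ℚ.* toℚ T)))
           (ℚᵘₚ.+-cong (ℚₚ.toℚᵘ-fromℚᵘ (mkℚᵘ (+ T) d-1))
             (ℚᵘₚ.≃-trans (ℚₚ.toℚᵘ-homo‿- (η ℚ.* toℚ T))
               (ℚᵘₚ.-‿cong (ℚᵘₚ.≃-trans (ℚₚ.toℚᵘ-homo-* η (toℚ T))
                 (ℚᵘₚ.*-cong (ℚᵘₚ.≃-refl {ηᵘ}) (ℚₚ.toℚᵘ-fromℚᵘ (mkℚᵘ (+ T) 0)))))))

-- The greedy process

module Greedy {k n : ℕ} (H : Graph k) (α : ℕ) (G : Graph n) (χ : Colouring G) (t : ℕ) where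

  record Side : Set where
    field
      colour   : Colour
      vertices : Subset n
      copies   : ℕ
      tiling   : Tiling H G χ colour vertices copies

    φ : Fin copies → Fin k → Fin n
    φ = proj₁ tiling

    cover⊆vertices : ∀ N → cover φ N ⊆ vertices
    cover⊆vertices = cover⊆ {H = H} {G = G} {χ = χ} tiling

    k*N≤∣cover∣ : ∀ N → N ≤ copies → k * N ≤ size (cover φ N)
    k*N≤∣cover∣ = ∣cover∣≥ {H = H} {G = G} {χ = χ} tiling

    first : ∀ N → N ≤ copies → Tiling H G χ colour (cover φ N) N
    first = first-copies {H = H} {G = G} {χ = χ} tiling

  open Side

  record Setup : Set where
    field
      X Y   : Side
      X∩Y=∅ : Disjoint (vertices X) (vertices Y)

  swap : Setup → Setup
  swap P = record { X = Y ; Y = X ; X∩Y=∅ = λ v v∈Y v∈X → X∩Y=∅ v v∈X v∈Y }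
    where open Setup P

  AnchoredCopy : Colour → Subset n → Subset n → Set
  AnchoredCopy c A B = Σ (Fin k → Fin n) λ ψ →
    IsCopy H G ψ × Monochromatic H χ c ψ × Inside ψ (A ∪ B) × α ≤ countIn ψ A

  RichFor : Setup → Set
  RichFor P = ∀ X′ Y′ → Disjoint X′ Y′ → size X′ ≡ t → size Y′ ≡ t →
              AnchoredCopy (colour Y) X′ Y′ ⊎ AnchoredCopy (colour X) Y′ X′
    where open Setup P

  -- Disjoint c-coloured copies of H; near and far collect their vertices on the anchoring side
  -- and on the other side, and as each copy has at least α vertices near, size far ≤ (k − α)·count.
  record Packing (c : Colour) : Set where
    field
      count         : ℕ
      copy          : Fin count → Fin k → Fin n
      valid         : ∀ a → IsCopy H G (copy a) × Monochromatic H χ c (copy a)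
      disjoint      : ∀ a b i j → a ≢ b → copy a i ≢ copy b j
      near far      : Subset n
      split         : ∀ a i → copy a i ∈ near ⊎ copy a i ∈ far
      ∣near∣+∣far∣≤ : size near + size far ≤ k * count
      anchored      : α * count + size far ≤ k * count

    as-tiling : ∀ {T} → near ⊆ T → far ⊆ T → Tiling H G χ c T count
    as-tiling {T} near⊆T far⊆T =
      copy , (λ a → proj₁ (valid a) , proj₂ (valid a) , in-T a) , disjoint
      where
      in-T : ∀ a i → copy a i ∈ T
      in-T a i with split a i
      ... | inj₁ ∈near = near⊆T ∈near
      ... | inj₂ ∈far  = far⊆T ∈far

  open Packing

  no-copies : ∀ {c} → Packing c
  no-copies = record
    { count = 0 ; copy = λ () ; valid = λ () ; disjoint = λ ()
    ; near = ⊥ ; far = ⊥ ; split = λ ()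
    ; ∣near∣+∣far∣≤ = ≤-reflexive (trans (cong₂ _+_ (∣⊥∣≡0 n) (∣⊥∣≡0 n)) (≡-sym (ℕ.*-zeroʳ k)))
    ; anchored      = ≤-reflexive (trans (cong₂ _+_ (ℕ.*-zeroʳ α) (∣⊥∣≡0 n)) (≡-sym (ℕ.*-zeroʳ k)))
    }

  add-copy : ∀ {c A B} (P : Packing c) → Disjoint A B → ((ψ , _) : AnchoredCopy c A B) →
             (∀ i a j → ψ i ≢ copy P a j) → Packing c
  add-copy {c} {A} {B} P A∩B=∅ (ψ , ψ-copy , ψ-mono , ψ⊆A∪B , α≤ψ∩A) ψ-new = record
    { count = suc (count P) ; copy = copy′ ; valid = valid′ ; disjoint = disjoint′
    ; near = near P ∪ (A ∩ image ψ) ; far = far P ∪ (B ∩ image ψ) ; split = split′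
    ; ∣near∣+∣far∣≤ = total ; anchored = anchored′ }
    where
    open ℕ.≤-Reasoning
    copy′ : Fin (suc (count P)) → Fin k → Fin n
    copy′ zero    = ψ
    copy′ (suc a) = copy P a
    valid′ : ∀ a → IsCopy H G (copy′ a) × Monochromatic H χ c (copy′ a)
    valid′ zero    = ψ-copy , ψ-mono
    valid′ (suc a) = valid P a
    disjoint′ : ∀ a b i j → a ≢ b → copy′ a i ≢ copy′ b j
    disjoint′ zero    zero    i j a≢b = ⊥-elim (a≢b refl)
    disjoint′ zero    (suc b) i j _   = ψ-new i b j
    disjoint′ (suc a) zero    i j _   = ψ-new j a i ∘ ≡-sym
    disjoint′ (suc a) (suc b) i j a≢b = disjoint P a b i j (a≢b ∘ cong suc)
    split′ : ∀ a i → copy′ a i ∈ near P ∪ (A ∩ image ψ)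
                   ⊎ copy′ a i ∈ far P ∪ (B ∩ image ψ)
    split′ zero i with x∈p∪q⁻ A B (ψ⊆A∪B i)
    ... | inj₁ ∈A = inj₁ (q⊆p∪q (near P) _ (x∈p∩q⁺ (∈A , ∈-image ψ i)))
    ... | inj₂ ∈B = inj₂ (q⊆p∪q (far P) _ (x∈p∩q⁺ (∈B , ∈-image ψ i)))
    split′ (suc a) i with split P a i
    ... | inj₁ ∈near = inj₁ (p⊆p∪q _ ∈near)
    ... | inj₂ ∈far  = inj₂ (p⊆p∪q _ ∈far)
    regroup : ∀ a b c d → (a + b) + (c + d) ≡ (b + d) + (a + c)
    regroup = solve-∀
    regroup′ : ∀ a b c d → (a + b) + (c + d) ≡ (a + d) + (b + c)
    regroup′ = solve-∀
    ∣∪∩image∣≤ : ∀ Q S → size (Q ∪ (S ∩ image ψ)) ≤ size Q + countIn ψ S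
    ∣∪∩image∣≤ Q S =
      ≤-trans (∣p∪q∣≤∣p∣+∣q∣ Q _) (+-monoʳ-≤ (size Q) (∣p∩image∣≤countIn ψ S))
    total : size (near P ∪ (A ∩ image ψ)) + size (far P ∪ (B ∩ image ψ)) ≤ k * suc (count P)
    total = begin
      size (near P ∪ (A ∩ image ψ)) + size (far P ∪ (B ∩ image ψ))
        ≤⟨ +-mono-≤ (∣∪∩image∣≤ (near P) A) (∣∪∩image∣≤ (far P) B) ⟩
      (size (near P) + countIn ψ A) + (size (far P) + countIn ψ B)
        ≡⟨ regroup (size (near P)) _ _ _ ⟩
      (countIn ψ A + countIn ψ B) + (size (near P) + size (far P))
        ≤⟨ +-mono-≤ (countIn-disjoint ψ A B A∩B=∅) (∣near∣+∣far∣≤ P) ⟩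
      k + k * count P
        ≡⟨ ≡-sym (ℕ.*-suc k (count P)) ⟩
      k * suc (count P) ∎
    anchored′ : α * suc (count P) + size (far P ∪ (B ∩ image ψ)) ≤ k * suc (count P)
    anchored′ = begin
      α * suc (count P) + size (far P ∪ (B ∩ image ψ))
        ≤⟨ +-mono-≤ (≤-reflexive (ℕ.*-suc α (count P))) (∣∪∩image∣≤ (far P) B) ⟩
      (α + α * count P) + (size (far P) + countIn ψ B)
        ≤⟨ +-monoˡ-≤ _ (+-monoˡ-≤ _ α≤ψ∩A) ⟩
      (countIn ψ A + α * count P) + (size (far P) + countIn ψ B)
        ≡⟨ regroup′ (countIn ψ A) _ _ _ ⟩
      (countIn ψ A + countIn ψ B) + (α * count P + size (far P))
        ≤⟨ +-mono-≤ (countIn-disjoint ψ A B A∩B=∅) (anchored P) ⟩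
      k + k * count P
        ≡⟨ ≡-sym (ℕ.*-suc k (count P)) ⟩
      k * suc (count P) ∎

  -- The used vertices U of a side lie in its first `depth` tiling copies, where depth is at most
  -- ⌈(|U| + t)/k⌉: this is what keeps the blue part of the final cluster small.
  record Frontier (S : Side) (U : Subset n) : Set where
    field
      depth        : ℕ
      depth≤copies : depth ≤ copies S
      U⊆cover      : U ⊆ cover (φ S) depth
      depth-tight  : k * depth < size U + t + k

    U⊆vertices : U ⊆ vertices S
    U⊆vertices = cover⊆vertices S depth ∘ U⊆cover

  open Frontier

  record Fresh (S : Side) (U : Subset n) (depth₀ : ℕ) : Set where
    field
      depth′        : ℕ
      depth₀≤depth′ : depth₀ ≤ depth′
      depth′≤copies : depth′ ≤ copies S
      depth′-tight  : k * depth′ < size U + t + k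
      set           : Subset n
      set⊆cover     : set ⊆ cover (φ S) depth′
      set∩U=∅       : Disjoint set U
      ∣set∣≡t       : size set ≡ t

    set⊆vertices : set ⊆ vertices S
    set⊆vertices = cover⊆vertices S depth′ ∘ set⊆cover

  open Fresh

  fresh : ∀ {S U} → 0 < k → (F : Frontier S U) → size U + t ≤ k * copies S →
          Fresh S U (depth F)
  fresh {S} {U} 0<k F room with ∃-ceiling (size U + t) 0<k
  ... | N , U+t≤kN , kN<U+t+k = record
    { depth′ = D ; depth₀≤depth′ = ℕ.m≤m⊔n _ N ; depth′≤copies = D≤copies
    ; depth′-tight = subst (_< size U + t + k) (≡-sym (ℕ.*-distribˡ-⊔ k (depth F) N))
                       (ℕ.⊔-pres-<m (depth-tight F) kN<U+t+k)
    ; set = proj₁ chosen ; set⊆cover = p∩q⊆p _ _ ∘ proj₁ (proj₂ chosen)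
    ; set∩U=∅ = λ x x∈set → x∈∁p⇒x∉p (proj₂ (x∈p∩q⁻ _ _ (proj₁ (proj₂ chosen) x∈set)))
    ; ∣set∣≡t = proj₂ (proj₂ chosen) }
    where
    open ℕ.≤-Reasoning
    D : ℕ
    D = depth F ⊔ N
    N≤copies : N ≤ copies S
    N≤copies = ℕ.≤-pred (ℕ.*-cancelˡ-< k N (suc (copies S)) (begin-strict
      k * N              <⟨ kN<U+t+k ⟩
      size U + t + k     ≤⟨ +-monoˡ-≤ k room ⟩
      k * copies S + k   ≡⟨ ℕ.+-comm _ k ⟩
      k + k * copies S   ≡⟨ ≡-sym (ℕ.*-suc k (copies S)) ⟩
      k * suc (copies S) ∎))
    D≤copies : D ≤ copies S
    D≤copies = ℕ.⊔-lub (depth≤copies F) N≤copies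
    available : t ≤ size (cover (φ S) D ∩ ∁ U)
    available = ℕ.+-cancelˡ-≤ (size U) _ _ (begin
      size U + t                          ≤⟨ U+t≤kN ⟩
      k * N                               ≤⟨ ℕ.*-monoʳ-≤ k (ℕ.m≤n⊔m (depth F) N) ⟩
      k * D                               ≤⟨ k*N≤∣cover∣ S D D≤copies ⟩
      size (cover (φ S) D)                ≤⟨ ∣p∣≤∣p∩∁q∣+∣q∣ (cover (φ S) D) U ⟩
      size (cover (φ S) D ∩ ∁ U) + size U ≡⟨ ℕ.+-comm _ (size U) ⟩
      size U + size (cover (φ S) D ∩ ∁ U) ∎)
    chosen : ∃[ X′ ] X′ ⊆ cover (φ S) D ∩ ∁ U × size X′ ≡ t
    chosen = ∃-⊆-of-size t (cover (φ S) D ∩ ∁ U) available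

  grow : ∀ {S U U′} (F : Frontier S U) (R : Fresh S U (depth F)) →
         U ⊆ U′ → U′ ⊆ U ∪ set R → Frontier S U′
  grow {S} {U} {U′} F R U⊆U′ U′⊆U∪set = record
    { depth = depth′ R ; depth≤copies = depth′≤copies R
    ; U⊆cover = ∪-least (cover-mono (φ S) (depth₀≤depth′ R) ∘ U⊆cover F) (set⊆cover R)
                ∘ U′⊆U∪set
    ; depth-tight = ℕ.<-≤-trans (depth′-tight R)
                      (+-monoˡ-≤ k (+-monoˡ-≤ t (p⊆q⇒∣p∣≤∣q∣ U⊆U′))) }

  start : ∀ {S} → 0 < k → Frontier S (⊥ ∪ ⊥)
  start {S} 0<k = record
    { depth = 0 ; depth≤copies = z≤n
    ; U⊆cover = ∪-least (⊥-elim ∘ ∉⊥) (⊥-elim ∘ ∉⊥)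
    ; depth-tight = subst (_< size (⊥ {n = n} ∪ ⊥) + t + k) (≡-sym (ℕ.*-zeroʳ k))
                    (ℕ.<-≤-trans 0<k (ℕ.m≤n+m k (size (⊥ {n = n} ∪ ⊥) + t))) }

  module _ (P : Setup) where
    open Setup P

    -- packX holds the copies anchored in X (red ones for the theorem), packY those anchored in Y.
    record State : Set where
      field
        packX  : Packing (colour Y)
        packY  : Packing (colour X)
        packX≤ : count packX ≤ copies X
        packY≤ : count packY ≤ copies Y
        frontX : Frontier X (near packX ∪ far packY)
        frontY : Frontier Y (near packY ∪ far packX)

      usedX usedY : Subset n
      usedX = near packX ∪ far packY
      usedY = near packY ∪ far packX

      progress : ℕ
      progress = count packX + count packY

  open State

  swap-state : ∀ {P} → State P → State (swap P)
  swap-state S = record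
    { packX = packY S ; packY = packX S ; packX≤ = packY≤ S ; packY≤ = packX≤ S
    ; frontX = frontY S ; frontY = frontX S }

  initial : ∀ {P} → 0 < k → State P
  initial 0<k = record
    { packX = no-copies ; packY = no-copies ; packX≤ = z≤n ; packY≤ = z≤n
    ; frontX = start 0<k ; frontY = start 0<k }

  module _ (P : Setup) where
    open Setup P

    fresh-sets-disjoint : ∀ {U V d d′} (RX : Fresh X U d) (RY : Fresh Y V d′) →
                          Disjoint (set RX) (set RY)
    fresh-sets-disjoint RX RY v v∈RX v∈RY =
      X∩Y=∅ v (set⊆vertices RX v∈RX) (set⊆vertices RY v∈RY)

  module _ {P : Setup} (S : State P) where
    open Setup P

    extend-packX : count (packX S) < copies X →
                   (RX : Fresh X (usedX S) (depth (frontX S)))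
                   (RY : Fresh Y (usedY S) (depth (frontY S))) →
                   AnchoredCopy (colour Y) (set RX) (set RY) → State P
    extend-packX p<copies RX RY new@(ψ , _ , _ , ψ⊆RX∪RY , _) = record
      { packX = add-copy (packX S) (fresh-sets-disjoint P RX RY) new ψ-new ; packY = packY S
      ; packX≤ = p<copies ; packY≤ = packY≤ S
      ; frontX = frontX′ ; frontY = frontY′ }
      where
      frontX′ : Frontier X ((near (packX S) ∪ (set RX ∩ image ψ)) ∪ far (packY S))
      frontX′ = grow (frontX S) RX
        (∪-least (p⊆p∪q _ ∘ p⊆p∪q _) (q⊆p∪q _ _))
        (∪-least (∪-least (p⊆p∪q _ ∘ p⊆p∪q _) (q⊆p∪q _ _ ∘ p∩q⊆p _ _)) (p⊆p∪q _ ∘ q⊆p∪q _ _))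
      frontY′ : Frontier Y (near (packY S) ∪ (far (packX S) ∪ (set RY ∩ image ψ)))
      frontY′ = grow (frontY S) RY
        (∪-least (p⊆p∪q _) (q⊆p∪q _ _ ∘ p⊆p∪q _))
        (∪-least (p⊆p∪q _ ∘ p⊆p∪q _) (∪-least (p⊆p∪q _ ∘ q⊆p∪q _ _) (q⊆p∪q _ _ ∘ p∩q⊆p _ _)))
      fresh-vs-old : ∀ {v} → v ∈ set RX ∪ set RY → ¬ (v ∈ near (packX S) ⊎ v ∈ far (packX S))
      fresh-vs-old {v} v∈R v∈old with x∈p∪q⁻ (set RX) _ v∈R | v∈old
      ... | inj₁ v∈RX | inj₁ v∈near = set∩U=∅ RX v v∈RX (p⊆p∪q _ v∈near)
      ... | inj₁ v∈RX | inj₂ v∈far  =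
        X∩Y=∅ v (set⊆vertices RX v∈RX) (U⊆vertices (frontY S) (q⊆p∪q _ _ v∈far))
      ... | inj₂ v∈RY | inj₁ v∈near =
        X∩Y=∅ v (U⊆vertices (frontX S) (p⊆p∪q _ v∈near)) (set⊆vertices RY v∈RY)
      ... | inj₂ v∈RY | inj₂ v∈far  = set∩U=∅ RY v v∈RY (q⊆p∪q _ _ v∈far)
      ψ-new : ∀ i a j → ψ i ≢ copy (packX S) a j
      ψ-new i a j ψi≡v = fresh-vs-old (ψ⊆RX∪RY i)
        (subst (λ v → v ∈ near (packX S) ⊎ v ∈ far (packX S)) (≡-sym ψi≡v) (split (packX S) a j))

  module _ {P : Setup} where
    open Setup P

    extend-packY : (S : State P) → count (packY S) < copies Y →
                   (RX : Fresh X (usedX S) (depth (frontX S)))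
                   (RY : Fresh Y (usedY S) (depth (frontY S))) →
                   AnchoredCopy (colour X) (set RY) (set RX) → State P
    extend-packY S q<copies RX RY new = swap-state (extend-packX (swap-state S) q<copies RY RX new)

    Terminal : ℕ → State P → Set
    Terminal s S = s ≤ k * progress S + t

    ∣near∪far∣≤ : ∀ {c c′} (A : Packing c) (B : Packing c′) →
                  size (near A ∪ far B) ≤ k * count A + k * count B
    ∣near∪far∣≤ A B = ≤-trans (∣p∪q∣≤∣p∣+∣q∣ (near A) (far B))
      (+-mono-≤ (≤-trans (m≤m+n (size (near A)) (size (far A))) (∣near∣+∣far∣≤ A))
                (≤-trans (ℕ.m≤n+m (size (far B)) (size (near B))) (∣near∣+∣far∣≤ B)))

    add-anchored-copy : RichFor P → (S : State P) →
                        count (packX S) < copies X → count (packY S) < copies Y →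
                        (RX : Fresh X (usedX S) (depth (frontX S)))
                        (RY : Fresh Y (usedY S) (depth (frontY S))) →
                        Σ (State P) λ S′ → progress S < progress S′
    add-anchored-copy rich S p<X q<Y RX RY
      with rich (set RX) (set RY) (fresh-sets-disjoint P RX RY) (∣set∣≡t RX) (∣set∣≡t RY)
    ... | inj₁ anchoredX = extend-packX S p<X RX RY anchoredX , ≤-refl
    ... | inj₂ anchoredY = extend-packY S q<Y RX RY anchoredY , ≤-reflexive (≡-sym (+-suc _ _))

    exhausted : ∀ {s M} (S : State P) → s ≤ k * M → M ≤ progress S → Terminal s S
    exhausted S s≤kM M≤progress =
      ≤-trans s≤kM (≤-trans (ℕ.*-monoʳ-≤ k M≤progress) (m≤m+n _ t))

    crowded : ∀ {s M U} (S : State P) → s ≤ k * M → ¬ (U + t ≤ k * M) →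
              U ≤ k * count (packX S) + k * count (packY S) → Terminal s S
    crowded S s≤kM full U≤ = ≤-trans s≤kM (≤-trans (ℕ.<⇒≤ (ℕ.≰⇒> full))
      (+-monoˡ-≤ t (≤-trans U≤ (≤-reflexive (≡-sym (ℕ.*-distribˡ-+ k _ _))))))

    step : ∀ {s} → 0 < k → RichFor P → s ≤ k * copies X → s ≤ k * copies Y → (S : State P) →
           Terminal s S ⊎ Σ (State P) λ S′ → progress S < progress S′
    step 0<k rich s≤kX s≤kY S
      with count (packX S) ℕ.<? copies X | count (packY S) ℕ.<? copies Y
    ... | no  p≮X | _       = inj₁ (exhausted S s≤kX (≤-trans (ℕ.≮⇒≥ p≮X) (m≤m+n _ _)))
    ... | yes _   | no  q≮Y = inj₁ (exhausted S s≤kY (≤-trans (ℕ.≮⇒≥ q≮Y) (ℕ.m≤n+m _ _)))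
    ... | yes p<X | yes q<Y
      with size (usedX S) + t ℕ.≤? k * copies X | size (usedY S) + t ℕ.≤? k * copies Y
    ...   | no  full  | _         = inj₁ (crowded S s≤kX full (∣near∪far∣≤ (packX S) (packY S)))
    ...   | yes _     | no  full  = inj₁ (crowded S s≤kY full
      (subst (size (usedY S) ≤_) (ℕ.+-comm (k * count (packY S)) _) (∣near∪far∣≤ (packY S) (packX S))))
    ...   | yes roomX | yes roomY =
      inj₂ (add-anchored-copy rich S p<X q<Y (fresh 0<k (frontX S) roomX) (fresh 0<k (frontY S) roomY))

    run : ∀ {s} → 0 < k → RichFor P → s ≤ k * copies X → s ≤ k * copies Y →
          ∀ fuel (S : State P) → copies X + copies Y ≤ progress S + fuel → Σ (State P) (Terminal s)
    run 0<k rich s≤kX s≤kY fuel S enough-fuel with step 0<k rich s≤kX s≤kY S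
    run 0<k rich s≤kX s≤kY fuel       S enough-fuel | inj₁ done = S , done
    run 0<k rich s≤kX s≤kY zero       S enough-fuel | inj₂ (S′ , progressed) =
      ⊥-elim (ℕ.<-irrefl refl (ℕ.<-≤-trans progressed (begin
        progress S′         ≤⟨ +-mono-≤ (packX≤ S′) (packY≤ S′) ⟩
        copies X + copies Y ≤⟨ enough-fuel ⟩
        progress S + 0      ≡⟨ ℕ.+-identityʳ _ ⟩
        progress S          ∎)))
      where open ℕ.≤-Reasoning
    run 0<k rich s≤kX s≤kY (suc fuel) S enough-fuel | inj₂ (S′ , progressed) =
      run 0<k rich s≤kX s≤kY fuel S′ (≤-trans enough-fuel
        (≤-trans (≤-reflexive (+-suc (progress S) fuel)) (+-monoˡ-≤ fuel progressed)))

  module _ (P : Setup) (d s : ℕ) where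
    open Setup P

    record Outcome : Set where
      field
        T        : Subset n
        T⊆X∪Y    : T ⊆ vertices X ∪ vertices Y
        nonempty : 0 < size T
        mX mY    : ℕ
        tilingX  : Tiling H G χ (colour X) T mX
        tilingY  : Tiling H G χ (colour Y) T mY
        balanced : Balanced k d t s (size T) mX mY ⊎ Balanced k d t s (size T) mY mX

  swap-outcome : ∀ {P d s} → Outcome (swap P) d s → Outcome P d s
  swap-outcome {P} O = record
    { T = T ; T⊆X∪Y = λ x∈T → subst (_ ∈_) (∪-comm (vertices (Setup.Y P)) _) (T⊆X∪Y x∈T)
    ; nonempty = nonempty
    ; mX = mY ; mY = mX ; tilingX = tilingY ; tilingY = tilingX ; balanced = ⊎-swap balanced }
    where open Outcome O

  module _ {P : Setup} where
    open Setup P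

    outcome : ∀ {d s} → 0 < k → α ≤ k → α + d ≡ k + k → t < s →
              (S : State P) → count (packY S) ≤ count (packX S) → Terminal s S → Outcome P d s
    outcome {d} {s} 0<k α≤k α+d≡2k t<s S q≤p terminal = record
      { T = T ; T⊆X∪Y = T⊆X∪Y ; nonempty = nonempty
      ; mX = N ; mY = p
      ; tilingX = Tiling-⊆ {H = H} {G = G} {χ = χ} (p⊆p∪q _) (first X N N≤copies)
      ; tilingY = as-tiling (packX S) near⊆T (q⊆p∪q _ _)
      ; balanced = inj₁ (∣T∣≤dN , ∣T∣<dp+t+k , s≤k[p+p]+t) }
      where
      open ℕ.≤-Reasoning
      nearX = near (packX S)
      farX  = far (packX S)
      farY  = far (packY S)
      p = count (packX S)
      q = count (packY S)
      D = depth (frontX S)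
      N = D ⊔ p
      T = cover (φ X) N ∪ farX
      anchored⇒ : ∀ {m M r} → m ≤ M → α * m + r ≤ k * m → k * M + r ≤ d * M
      anchored⇒ = ap+r≤bp⇒bN+r≤dN {d = d} α≤k α+d≡2k
      N≤copies : N ≤ copies X
      N≤copies = ℕ.⊔-lub (depth≤copies (frontX S)) (packX≤ S)
      near⊆T : nearX ⊆ T
      near⊆T = p⊆p∪q _ ∘ cover-mono (φ X) (ℕ.m≤m⊔n D p) ∘ U⊆cover (frontX S) ∘ p⊆p∪q _
      T⊆X∪Y : T ⊆ vertices X ∪ vertices Y
      T⊆X∪Y = ∪-least (p⊆p∪q _ ∘ cover⊆vertices X N)
                      (q⊆p∪q _ _ ∘ U⊆vertices (frontY S) ∘ q⊆p∪q _ _)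
      s≤k[p+p]+t : s ≤ k * (p + p) + t
      s≤k[p+p]+t = ≤-trans terminal (+-monoˡ-≤ t (ℕ.*-monoʳ-≤ k (+-monoʳ-≤ p q≤p)))
      0<N : 0 < N
      0<N = ℕ.<-≤-trans (t<s⇒0<m {k} t<s s≤k[p+p]+t) (ℕ.m≤n⊔m D p)
      nonempty : 0 < size T
      nonempty = begin-strict
        0                    <⟨ 0<k ⟩
        k                    ≡⟨ ≡-sym (ℕ.*-identityʳ k) ⟩
        k * 1                ≤⟨ ℕ.*-monoʳ-≤ k 0<N ⟩
        k * N                ≤⟨ k*N≤∣cover∣ X N N≤copies ⟩
        size (cover (φ X) N) ≤⟨ ∣p∣≤∣p∪q∣ (cover (φ X) N) farX ⟩
        size T               ∎
      ∣T∣≤kN+far : size T ≤ k * N + size farX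
      ∣T∣≤kN+far = ≤-trans (∣p∪q∣≤∣p∣+∣q∣ (cover (φ X) N) farX)
                           (+-monoˡ-≤ (size farX) (∣cover∣≤ (φ X) N))
      kp+farY≤dp : k * p + size farY ≤ d * p
      kp+farY≤dp = anchored⇒ q≤p (anchored (packY S))
      ∣T∣≤dN : size T ≤ d * N
      ∣T∣≤dN = ≤-trans ∣T∣≤kN+far
        (anchored⇒ (ℕ.m≤n⊔m D p) (anchored (packX S)))
      kD+far<dp+t+k : k * D + size farX < d * p + t + k
      kD+far<dp+t+k = begin-strict
        k * D + size farX
          <⟨ ℕ.+-monoˡ-< _ (depth-tight (frontX S)) ⟩
        (size (nearX ∪ farY) + t + k) + size farX
          ≤⟨ +-monoˡ-≤ _ (+-monoˡ-≤ k (+-monoˡ-≤ t (∣p∪q∣≤∣p∣+∣q∣ nearX farY))) ⟩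
        (size nearX + size farY + t + k) + size farX
          ≡⟨ regroup (size nearX) (size farY) t k (size farX) ⟩
        (size nearX + size farX) + size farY + t + k
          ≤⟨ +-monoˡ-≤ k (+-monoˡ-≤ t (+-monoˡ-≤ _ (∣near∣+∣far∣≤ (packX S)))) ⟩
        k * p + size farY + t + k
          ≤⟨ +-monoˡ-≤ k (+-monoˡ-≤ t kp+farY≤dp) ⟩
        d * p + t + k ∎
        where
        regroup : ∀ a b t k c → (a + b + t + k) + c ≡ (a + c) + b + t + k
        regroup = solve-∀
      kp+far<dp+t+k : k * p + size farX < d * p + t + k
      kp+far<dp+t+k = ℕ.≤-<-trans (anchored⇒ ≤-refl (anchored (packX S)))
                        (ℕ.≤-<-trans (m≤m+n (d * p) t) (ℕ.m<m+n (d * p + t) 0<k))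
      ∣T∣<dp+t+k : size T < d * p + t + k
      ∣T∣<dp+t+k = ℕ.≤-<-trans ∣T∣≤kN+far (begin-strict
        k * N + size farX
          ≡⟨ cong (_+ size farX) (ℕ.*-distribˡ-⊔ k D p) ⟩
        (k * D ⊔ k * p) + size farX
          ≡⟨ ℕ.+-distribʳ-⊔ (size farX) (k * D) (k * p) ⟩
        (k * D + size farX) ⊔ (k * p + size farX)
          <⟨ ℕ.⊔-pres-<m kD+far<dp+t+k kp+far<dp+t+k ⟩
        d * p + t + k ∎)

  greedy : ∀ {P d s} → 0 < k → α ≤ k → α + d ≡ k + k → t < s → RichFor P →
           s ≤ k * copies (Setup.X P) → s ≤ k * copies (Setup.Y P) → Outcome P d s
  greedy {P} {s = s} 0<k α≤k α+d≡2k t<s rich s≤kX s≤kY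
    with run 0<k rich s≤kX s≤kY (copies (Setup.X P) + copies (Setup.Y P)) (initial 0<k) ≤-refl
  ... | S , terminal with count (packY S) ℕ.≤? count (packX S)
  ...   | yes q≤p = outcome 0<k α≤k α+d≡2k t<s S q≤p terminal
  ...   | no  q≰p = swap-outcome (outcome 0<k α≤k α+d≡2k t<s (swap-state S) (ℕ.<⇒≤ (ℕ.≰⇒> q≰p))
                      (subst (λ x → s ≤ k * x + t) (ℕ.+-comm (count (packX S)) _) terminal))

-- The cluster

α≤k : ∀ {k} {H : Graph k} {α} → IsIndependenceNumber H α → α ≤ k
α≤k ((S , _ , ∣S∣≡α) , _) = subst (_≤ _) ∣S∣≡α (∣p∣≤n S)

α+[2k∸α]≡k+k : ∀ {k α} → α ≤ k → α + (2 * k ∸ α) ≡ k + k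
α+[2k∸α]≡k+k {k} α≤k =
  trans (ℕ.m+[n∸m]≡n (≤-trans α≤k (m≤m+n k (k + 0)))) (cong (_+_ k) (ℕ.+-identityʳ k))

k≤2k∸α : ∀ {k α} → α ≤ k → k ≤ 2 * k ∸ α
k≤2k∸α {k} {α} α≤k = ℕ.+-cancelˡ-≤ α _ _
  (subst (α + k ≤_) (≡-sym (α+[2k∸α]≡k+k α≤k)) (+-monoˡ-≤ k α≤k))

b≤ad⇒ClusterSize : ∀ {a b d T} → b ≤ a * d → ClusterSize a b d T 0
b≤ad⇒ClusterSize {a} {b} {d} {T} b≤ad =
  ≤-trans (ℕ.*-monoˡ-≤ T b≤ad) (ℕ.m≤n+m (a * d * T) (b * d * 0))

-- For t = 0, richness would produce a copy of H inside ∅.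
Rich⇒0<t : ∀ {k} {H : Graph k} {α} {G : Graph n} {t} → 0 < k → Colouring G → Rich H α G t → 0 < t
Rich⇒0<t {n} {t = zero} 0<k χ rich with rich χ ⊥ ⊥ (λ _ x∈⊥ _ → ∉⊥ x∈⊥) (∣⊥∣≡0 n) (∣⊥∣≡0 n)
... | inj₁ (φ , _ , _ , φ⊆∅ , _) = ⊥-elim ([ ∉⊥ , ∉⊥ ]′ (x∈p∪q⁻ ⊥ ⊥ (φ⊆∅ (fromℕ< 0<k))))
... | inj₂ (φ , _ , _ , φ⊆∅ , _) = ⊥-elim ([ ∉⊥ , ∉⊥ ]′ (x∈p∪q⁻ ⊥ ⊥ (φ⊆∅ (fromℕ< 0<k))))
Rich⇒0<t {t = suc t} _ _ _ = s≤s z≤n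

module _ {k} (H : Graph k) (α : ℕ) (G : Graph n) (χ : Colouring G) where

  no-tiling : ∀ {c S} → Tiling H G χ c S 0
  no-tiling = (λ ()) , (λ ()) , (λ ())

  cluster : ∀ {η a T} → ℚ.↥ η ≡ + a → 1 ≤ 2 * k ∸ α → 0 < size T →
            (Σ ℕ λ m → Tiling H G χ red T m × ClusterSize a (ℚ.↧ₙ η) (2 * k ∸ α) (size T) m) →
            (Σ ℕ λ m → Tiling H G χ blue T m × ClusterSize a (ℚ.↧ₙ η) (2 * k ∸ α) (size T) m) →
            Cluster H α G χ η T
  cluster {η} ↥η≡a 1≤d 0<∣T∣ (m-red , red-tiling , red-size) (m-blue , blue-tiling , blue-size) =
    0<∣T∣ , (m-red , red-tiling , ClusterSize⇒≤ η ↥η≡a 1≤d red-size)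
          , (m-blue , blue-tiling , ClusterSize⇒≤ η ↥η≡a 1≤d blue-size)

  sparse-cluster : ∀ η {a T} → ℚ.↥ η ≡ + a → 3 ≤ k → α ≤ k → ℚ.↧ₙ η ≤ a * (2 * k ∸ α) →
                   0 < size T → Cluster H α G χ η T
  sparse-cluster η {a} ↥η≡a 3≤k α≤k b≤ad 0<∣T∣ =
    cluster {η} ↥η≡a (≤-trans (≤-trans (s≤s z≤n) 3≤k) (k≤2k∸α α≤k)) 0<∣T∣
            (0 , no-tiling , b≤ad⇒ClusterSize {a} b≤ad)
            (0 , no-tiling , b≤ad⇒ClusterSize {a} b≤ad)

  module _ {t : ℕ} where
    open Greedy H α G χ t

    setup : ∀ {X Y m₁ m₂} → Disjoint X Y → Tiling H G χ blue X m₁ → Tiling H G χ red Y m₂ → Setup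
    setup {X} {Y} {m₁} {m₂} X∩Y=∅ blueX redY = record
      { X = record { colour = blue ; vertices = X ; copies = m₁ ; tiling = blueX }
      ; Y = record { colour = red  ; vertices = Y ; copies = m₂ ; tiling = redY }
      ; X∩Y=∅ = X∩Y=∅ }

    Rich⇒RichFor : Rich H α G t → ∀ {X Y m₁ m₂} (X∩Y=∅ : Disjoint X Y)
                   (blueX : Tiling H G χ blue X m₁) (redY : Tiling H G χ red Y m₂) →
                   RichFor (setup X∩Y=∅ blueX redY)
    Rich⇒RichFor rich _ _ _ X′ Y′ X′∩Y′=∅ ∣X′∣≡t ∣Y′∣≡t
      with rich χ X′ Y′ X′∩Y′=∅ ∣X′∣≡t ∣Y′∣≡t
    ... | inj₁ red-copy = inj₁ red-copy
    ... | inj₂ (φ , φ-copy , φ-blue , φ⊆X′∪Y′ , α≤∣φ∩Y′∣) =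
      inj₂ (φ , φ-copy , φ-blue , (λ i → subst (φ i ∈_) (∪-comm X′ Y′) (φ⊆X′∪Y′ i)) , α≤∣φ∩Y′∣)

  dense-cluster : ∀ η {a s X Y m₁ m₂} → ℚ.↥ η ≡ + a → 1 ≤ a → 3 ≤ k → α ≤ k →
                  a * (2 * k ∸ α) < ℚ.↧ₙ η → Rich H α G ∣ floor (η ℚ.* η ℚ.* toℚ s) ∣ → Disjoint X Y →
                  Tiling H G χ blue X m₁ → s ≤ k * m₁ → Tiling H G χ red Y m₂ → s ≤ k * m₂ →
                  Σ (Subset n) λ T → T ⊆ X ∪ Y × Cluster H α G χ η T
  dense-cluster η {a} {s} ↥η≡a 1≤a 3≤k α≤k ad<b rich X∩Y=∅ blueX s≤km₁ redY s≤km₂ =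
    T , T⊆X∪Y , cluster {η} ↥η≡a (≤-trans 0<k k≤d) nonempty
                        (mY , tilingY , proj₂ sizes) (mX , tilingX , proj₁ sizes)
    where
    t b d : ℕ
    t = ∣ floor (η ℚ.* η ℚ.* toℚ s) ∣
    b = ℚ.↧ₙ η
    d = 2 * k ∸ α
    0<k : 0 < k
    0<k = ≤-trans (s≤s z≤n) 3≤k
    k≤d : k ≤ d
    k≤d = k≤2k∸α α≤k
    1≤t : 1 ≤ t
    1≤t = Rich⇒0<t {H = H} {α} 0<k χ rich
    tb²≤a²s : t * (b * b) ≤ a * a * s
    tb²≤a²s = ⌊η²s⌋-bound η ↥η≡a s
    3a≤b : 3 * a ≤ b
    3a≤b = ≤-trans (3≤d⇒3a≤ad {a} (≤-trans 3≤k k≤d)) (ℕ.<⇒≤ ad<b)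
    t<s : t < s
    t<s = begin-strict
      t     <⟨ ℕ.m<m*n t 9 {{>-nonZero 1≤t}} (s≤s (s≤s z≤n)) ⟩
      t * 9 ≡⟨ ℕ.*-comm t 9 ⟩
      9 * t ≤⟨ 9t≤s {a} {b} {t} 1≤a 3a≤b tb²≤a²s ⟩
      s     ∎
      where open ℕ.≤-Reasoning
    open Greedy.Outcome (Greedy.greedy H α G χ t {setup X∩Y=∅ blueX redY} {d} {s}
                           0<k α≤k (α+[2k∸α]≡k+k α≤k) t<s (Rich⇒RichFor rich X∩Y=∅ blueX redY)
                           s≤km₁ s≤km₂)
    sizes : ClusterSize a b d (size T) mX × ClusterSize a b d (size T) mY
    sizes = [ Balanced⇒ClusterSize {a} {b} 3≤k k≤d 1≤a ad<b 1≤t tb²≤a²s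
            , ×-swap ∘ Balanced⇒ClusterSize {a} {b} 3≤k k≤d 1≤a ad<b 1≤t tb²≤a²s
            ]′ balanced

lemma2p9 : ∀ {k n} (H : Graph k) (α : ℕ) → IsIndependenceNumber H α → 3 ≤ k →
    (s : ℕ) → 1 ≤ s → (η : ℚ) → 0ℚ <ℚ η →
    (G : Graph n) → Rich H α G ∣ floor (η *ℚ η *ℚ toℚ s) ∣ →
    ∀ (X Y : Subset n) → Disjoint X Y → size X ≡ s → size Y ≡ s →
    ∀ (χ : Colouring G) →
    (Σ ℕ λ m → Tiling H G χ blue X m × s ≤ k * m) →
    (Σ ℕ λ m → Tiling H G χ red Y m × s ≤ k * m) →
    Σ (Subset n) λ T → T ⊆ X ∪ Y × Cluster H α G χ η T
lemma2p9 {k} H α indep 3≤k s 1≤s η 0<η G rich X Y X∩Y=∅ ∣X∣≡s _ χ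
         (_ , blueX , s≤km₁) (_ , redY , s≤km₂)
  with positive⇒numerator 0<η
... | a , ↥η≡a , 1≤a with a * (2 * k ∸ α) ℕ.<? ℚ.↧ₙ η
...   | yes ad<b = dense-cluster H α G χ η ↥η≡a 1≤a 3≤k (α≤k {H = H} indep) ad<b rich X∩Y=∅
                                 blueX s≤km₁ redY s≤km₂
...   | no  ad≮b = X , p⊆p∪q Y , sparse-cluster H α G χ η ↥η≡a 3≤k (α≤k {H = H} indep)
                                               (ℕ.≮⇒≥ ad≮b) (subst (0 <_) (≡-sym ∣X∣≡s) 1≤s)
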